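{- Let $\Omega$ be a (not necessarily countable) $D$-set, let $A\subseteq\Omega$ (with the induced $D$-relation), and let $\mathcal{C}$ be a splitting of $A$. Then there exists a splitting $\mathcal{C}'$ of $\Omega$ extending $\mathcal{C}$, in the sense that every sector of $\mathcal{C}$ is the intersection with $A$ of a sector of $\mathcal{C}'$. Furthermore, if $\mathcal{C}$ is a node splitting then $\mathcal{C}'$ is unique, and if $\mathcal{C}$ is an edge splitting then $\mathcal{C}'$ may be taken to be an edge splitting.
   Context: A $D$-set is a set $\Omega$ with a quaternary relation $D$, written $D(wx;yz)$, such that for all $w,x,y,z\in\Omega$: (D1) $D(wx;yz)\to (D(xw;yz)\wedge D(yz;wx))$; (D2) $D(wx;yz)\to\neg D(wy;xz)$; (D3) $D(wx;yz)\to\forall v\,(D(vx;yz)\vee D(wx;yv))$; (D4) $(w\neq y\wedge x\neq y)\to D(wx;yy)$. A splitting of a $D$-set $X$ is a partition of $X$ into at least two parts (sectors) such that (i) if $a,b$ lie in a part $\Sigma$ and $c,d\in X\setminus\Sigma$ then $D(ab;cd)$, and (ii) if $a,b,c,d$ lie in four distinct parts then $\neg D(ab;cd)$. A node splitting has more than two sectors; an edge splitting has exactly two. -}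

module Defs where

open import Data.Product using (Σ; Σ-syntax; ∃; ∃-syntax; _×_; _,_; proj₁; proj₂)
open import Data.Sum using (_⊎_)
open import Relation.Nullary using (¬_)
open import Relation.Binary.PropositionalEquality using (_≡_)
open import Relation.Binary.Structures using (IsEquivalence)

-- A quaternary relation; D w x y z  stands for  D(wx;yz).
QRel : Set → Set₁
QRel X = X → X → X → X → Set

record IsDSet {X : Set} (D : QRel X) : Set where
  field
    D1 : ∀ {w x y z} → D w x y z → D x w y z × D y z w x
    D2 : ∀ {w x y z} → D w x y z → ¬ D w y x z
    D3 : ∀ {w x y z} → D w x y z → ∀ v → D v x y z ⊎ D w x y v
    D4 : ∀ {w x y} → ¬ (w ≡ y) → ¬ (x ≡ y) → D w x y y

induced : {Ω : Set} → QRel Ω → (A : Ω → Set) → QRel (Σ Ω A)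
induced D A w x y z = D (proj₁ w) (proj₁ x) (proj₁ y) (proj₁ z)

-- A splitting of (X , D): a partition of X, represented by the equivalence
-- relation "lie in the same part" (parts = equivalence classes), with at
-- least two parts, satisfying (i) and (ii).
record Splitting {X : Set} (D : QRel X) : Set₁ where
  field
    _∼_       : X → X → Set
    isEquiv   : IsEquivalence _∼_
    twoParts  : ∃[ x ] ∃[ y ] ¬ (x ∼ y)
    sectorD   : ∀ {a b c d} → a ∼ b → ¬ (a ∼ c) → ¬ (a ∼ d) → D a b c d
    fourParts : ∀ {a b c d} → ¬ (a ∼ b) → ¬ (a ∼ c) → ¬ (a ∼ d)
              → ¬ (b ∼ c) → ¬ (b ∼ d) → ¬ (c ∼ d) → ¬ D a b c d

open Splitting public

IsNode : {X : Set} {D : QRel X} → Splitting D → Set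
IsNode C = ∃[ a ] ∃[ b ] ∃[ c ] (¬ _∼_ C a b × ¬ _∼_ C a c × ¬ _∼_ C b c)

IsEdge : {X : Set} {D : QRel X} → Splitting D → Set
IsEdge C = ∃[ a ] ∃[ b ] (¬ _∼_ C a b × (∀ c → _∼_ C a c ⊎ _∼_ C b c))

-- C' (a splitting of Ω) extends C (a splitting of A ⊆ Ω): every sector of C
-- (the class of some a ∈ A) is the intersection with A of a sector of C'
-- (the class of some ω ∈ Ω).
Extends : {Ω : Set} {D : QRel Ω} {A : Ω → Set}
        → Splitting (induced D A) → Splitting D → Set
Extends {Ω} {D} {A} C C' =
  ∀ (a : Σ Ω A) → ∃[ ω ] (∀ (b : Σ Ω A) →
     (_∼_ C a b → _∼_ C' ω (proj₁ b)) × (_∼_ C' ω (proj₁ b) → _∼_ C a b))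

SameSplitting : {X : Set} {D : QRel X} → Splitting D → Splitting D → Set
SameSplitting C C' = ∀ x y → (_∼_ C x y → _∼_ C' x y) × (_∼_ C' x y → _∼_ C x y)

-- Node case: fix t₁, t₂, t₃ ∈ A in distinct sectors of C.  In any extension, x ∼ y forces
-- D(xy;tᵢtⱼ) for the two tᵢ outside the sector of x, by (i); conversely D(xy;ab) with a, b in
-- distinct sectors forces x ∼ y, because two pairs that each straddle a splitting are never
-- D-related (by (ii), and by (i) with D2 when the four points meet fewer sectors).  So the only
-- candidate is "x ∼ y iff D(xy;ab) for some a, b in distinct sectors of C", and the D-axioms
-- show it is a splitting of Ω.  Edge case: with sectors of a₀ and b₀, put ω on the side of b₀
-- when D(ωb;aa') for all a, a' ~ a₀ and b ~ b₀; via D3 any two points off that side are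
-- D-separated from any two on it, so the two sides form an edge splitting of Ω.

module Submission where

open import Defs
open import Level using (0ℓ)
open import Axiom.ExcludedMiddle using (ExcludedMiddle)
open import Axiom.DoubleNegationElimination using (em⇒dne)
open import Data.Empty using (⊥-elim)
open import Data.Product using (Σ; Σ-syntax; ∃-syntax; _×_; _,_; proj₁; proj₂)
open import Data.Sum as Sum using (_⊎_; inj₁; inj₂; [_,_])
open import Function using (_∘_; _on_; _⇔_; mk⇔; Equivalence)
import Function.Properties.Equivalence as ⇔
open import Relation.Binary.Construct.On using (isEquivalence)
open import Relation.Binary.PropositionalEquality
  using (_≡_; _≢_; refl; sym; subst; ≢-sym)
  renaming (isEquivalence to ≡-isEquivalence)
open import Relation.Binary.Structures using (IsEquivalence)
open import Relation.Nullary using (¬_; yes; no; ¬¬-excluded-middle)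

SomePairOf : {X : Set} → (X → X → Set) → X → X → X → Set
SomePairOf Q t₁ t₂ t₃ = Q t₂ t₃ ⊎ Q t₁ t₃ ⊎ Q t₁ t₂

mapSomePair : {X : Set} {Q Q′ : X → X → Set} {t₁ t₂ t₃ : X}
  → (∀ {s t} → Q s t → Q′ s t) → SomePairOf Q t₁ t₂ t₃ → SomePairOf Q′ t₁ t₂ t₃
mapSomePair f = Sum.map f (Sum.map f f)

module _ (em : ExcludedMiddle 0ℓ) {X : Set} {_≈_ : X → X → Set} (≈-equiv : IsEquivalence _≈_)
  where
  module ≈ = IsEquivalence ≈-equiv

  avoidsTwoOfThree : ∀ {t₁ t₂ t₃} → ¬ t₁ ≈ t₂ → ¬ t₁ ≈ t₃ → ¬ t₂ ≈ t₃
    → ∀ x → SomePairOf (λ s t → ¬ x ≈ s × ¬ x ≈ t) t₁ t₂ t₃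
  avoidsTwoOfThree {t₁} {t₂} t₁≉t₂ t₁≉t₃ t₂≉t₃ x with em {x ≈ t₁} | em {x ≈ t₂}
  ... | yes x≈t₁ | _        = inj₁ (t₁≉t₂ ∘ ≈.trans (≈.sym x≈t₁) , t₁≉t₃ ∘ ≈.trans (≈.sym x≈t₁))
  ... | no x≉t₁  | yes x≈t₂ = inj₂ (inj₁ (x≉t₁ , t₂≉t₃ ∘ ≈.trans (≈.sym x≈t₂)))
  ... | no x≉t₁  | no x≉t₂  = inj₂ (inj₂ (x≉t₁ , x≉t₂))

¬IsNode⇒IsEdge : ExcludedMiddle 0ℓ → {X : Set} {D : QRel X} (S : Splitting D)
  → ¬ IsNode S → IsEdge S
¬IsNode⇒IsEdge em S ¬node with twoParts S
... | a , b , a≁b = a , b , a≁b , λ c →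
  em⇒dne em λ neither → ¬node (a , b , c , a≁b , neither ∘ inj₁ , neither ∘ inj₂)

Extends-reflects : {Ω : Set} {D : QRel Ω} {A : Ω → Set}
  (C : Splitting (induced D A)) (C′ : Splitting D) → Extends C C′
  → ∀ a b → _∼_ C′ (proj₁ a) (proj₁ b) → _∼_ C a b
Extends-reflects C C′ ext a b a∼′b with ext a
... | ω , sector = proj₂ (sector b) (C′.trans (proj₁ (sector a) C.refl) a∼′b)
  where
  module C  = IsEquivalence (isEquiv C)
  module C′ = IsEquivalence (isEquiv C′)

module Symmetries {X : Set} {R : QRel X}
  (D1 : ∀ {w x y z} → R w x y z → R x w y z × R y z w x) where

  D-swapˡ : ∀ {w x y z} → R w x y z → R x w y z
  D-swapˡ p = proj₁ (D1 p)

  D-flip : ∀ {w x y z} → R w x y z → R y z w x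
  D-flip p = proj₂ (D1 p)

  D-swapʳ : ∀ {w x y z} → R w x y z → R w x z y
  D-swapʳ p = D-flip (D-swapˡ (D-flip p))

module DSetProperties {Ω : Set} {D : QRel Ω} (ds : IsDSet D) where
  open IsDSet ds public
  open Symmetries {R = D} D1 public

  D-trans : ∀ {x y z a b} → D x y a b → D y z a b → D x z a b
  D-trans {x} {y} {z} xyDab yzDab with D3 (D-swapˡ xyDab) z | D3 yzDab x
  ... | inj₁ zxDab | _          = D-swapˡ zxDab
  ... | inj₂ _     | inj₁ xzDab = xzDab
  ... | inj₂ yxDaz | inj₂ yzDax = ⊥-elim (D2 (D-swapʳ yxDaz) (D-swapʳ yzDax))

  D-transʳ : ∀ {p q u v w} → D p q u v → D p q v w → D p q u w
  D-transʳ pqDuv pqDvw = D-flip (D-trans (D-flip pqDuv) (D-flip pqDvw))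

  ¬D-repeat : ∀ {w x z} → ¬ D w x w z
  ¬D-repeat {w} {x} {z} wxDwz = ¬¬-excluded-middle {A = x ≡ w} λ
    { (yes refl) → D2 wxDwz wxDwz
    ; (no x≢w)   → ¬¬-excluded-middle {A = z ≡ w} λ
        { (yes refl) → D2 wxDwz (D-swapʳ (D-flip wxDwz))
        ; (no z≢w)   → D2 wxDwz (D-flip (D4 x≢w z≢w))
        }
    }

  D-exchange : ∀ {x y z a c} → D x y a z → D y z c x → D a z c x
  D-exchange {x} {y} {z} {a} {c} xyDaz yzDcx
    with D3 (D-swapʳ (D-flip xyDaz)) c
  ... | inj₁ czDyx = ⊥-elim (D2 (D-swapʳ yzDcx) (D-swapʳ (D-flip czDyx)))
  ... | inj₂ azDyc with D3 (D-swapʳ azDyc) x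
  ...   | inj₁ xzDcy = ⊥-elim (D2 yzDcx (D-swapʳ (D-swapˡ (D-flip xzDcy))))
  ...   | inj₂ azDcx = azDcx

module SplittingProperties {X : Set} {R : QRel X} (em : ExcludedMiddle 0ℓ)
  (D1 : ∀ {w x y z} → R w x y z → R x w y z × R y z w x)
  (D2 : ∀ {w x y z} → R w x y z → ¬ R w y x z)
  (S : Splitting R) where

  open Symmetries {R = R} D1

  private
    _~_ = _∼_ S
    module S = IsEquivalence (isEquiv S)

  ¬D-straddling : ∀ {a b c d} → ¬ a ~ b → ¬ c ~ d → ¬ R a b c d
  ¬D-straddling {a} {b} {c} {d} a≁b c≁d abDcd
    with em {a ~ c} | em {a ~ d} | em {b ~ c} | em {b ~ d}
  ... | yes a∼c | _ | _ | _ =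
    D2 abDcd (sectorD S a∼c a≁b (c≁d ∘ S.trans (S.sym a∼c)))
  ... | no a≁c | yes a∼d | _ | _ =
    D2 (D-swapʳ abDcd) (sectorD S a∼d a≁b a≁c)
  ... | no _ | no _ | yes b∼c | _ =
    D2 (D-swapˡ abDcd) (sectorD S b∼c (a≁b ∘ S.sym) (c≁d ∘ S.trans (S.sym b∼c)))
  ... | no _ | no _ | no b≁c | yes b∼d =
    D2 (D-swapʳ (D-swapˡ abDcd)) (sectorD S b∼d (a≁b ∘ S.sym) b≁c)
  ... | no a≁c | no a≁d | no b≁c | no b≁d =
    fourParts S a≁b a≁c a≁d b≁c b≁d c≁d abDcd

  D⇒∼ : ∀ {x y a b} → ¬ a ~ b → R x y a b → x ~ y
  D⇒∼ a≁b xyDab = em⇒dne em λ x≁y → ¬D-straddling x≁y a≁b xyDab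

  ∼⇒D-someTriplePair : ∀ {x y t₁ t₂ t₃} → ¬ t₁ ~ t₂ → ¬ t₁ ~ t₃ → ¬ t₂ ~ t₃
    → x ~ y → SomePairOf (R x y) t₁ t₂ t₃
  ∼⇒D-someTriplePair {x} {y} t₁≁t₂ t₁≁t₃ t₂≁t₃ x∼y =
    mapSomePair {Q′ = R x y} (λ { (x≁s , x≁t) → sectorD S x∼y x≁s x≁t })
      (avoidsTwoOfThree em (isEquiv S) t₁≁t₂ t₁≁t₃ t₂≁t₃ x)

module NodeExtension {Ω : Set} {D : QRel Ω} (em : ExcludedMiddle 0ℓ) (ds : IsDSet D)
  {A : Ω → Set} (C : Splitting (induced D A)) (t₁ t₂ t₃ : Σ Ω A)
  (t₁≁t₂ : ¬ _∼_ C t₁ t₂) (t₁≁t₃ : ¬ _∼_ C t₁ t₃) (t₂≁t₃ : ¬ _∼_ C t₂ t₃) where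

  open DSetProperties ds
  open SplittingProperties em D1 D2 C using (¬D-straddling)

  private
    P = Σ Ω A
    _~_ = _∼_ C
    module C = IsEquivalence (isEquiv C)

  Separated : {X : Set} → QRel X → (P → X) → X → X → Set
  Separated R ι x y = Σ[ a ∈ P ] Σ[ b ∈ P ] (¬ a ~ b × R x y (ι a) (ι b))

  _≈_ : Ω → Ω → Set
  _≈_ = Separated D proj₁

  someTriplePair⇒Separated : {X : Set} {R : QRel X} {ι : P → X} {x y : X}
    → SomePairOf (R x y) (ι t₁) (ι t₂) (ι t₃) → Separated R ι x y
  someTriplePair⇒Separated =
    [ (λ p → t₂ , t₃ , t₂≁t₃ , p) , [ (λ p → t₁ , t₃ , t₁≁t₃ , p) , (λ p → t₁ , t₂ , t₁≁t₂ , p) ] ]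

  ∼⇔Separated : {X : Set} {R : QRel X}
    (R-D1 : ∀ {w x y z} → R w x y z → R x w y z × R y z w x)
    (R-D2 : ∀ {w x y z} → R w x y z → ¬ R w y x z)
    (S : Splitting R) (ι : P → X) → (∀ a b → _∼_ S (ι a) (ι b) → a ~ b)
    → ∀ {x y} → _∼_ S x y ⇔ Separated R ι x y
  ∼⇔Separated {R = R} R-D1 R-D2 S ι reflects = mk⇔
    (λ x∼y → someTriplePair⇒Separated {R = R} {ι = ι}
      (∼⇒D-someTriplePair (t₁≁t₂ ∘ reflects _ _) (t₁≁t₃ ∘ reflects _ _) (t₂≁t₃ ∘ reflects _ _) x∼y))
    (λ { (a , b , a≁b , xyDab) → D⇒∼ (a≁b ∘ reflects a b) xyDab })
    where open SplittingProperties em R-D1 R-D2 S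

  ≁⇒≢ : ∀ {a b} → ¬ a ~ b → proj₁ a ≢ proj₁ b
  ≁⇒≢ {a} a≁b a≡b =
    ¬D-repeat (subst (λ t → D (proj₁ a) (proj₁ a) t t) (sym a≡b) (sectorD C C.refl a≁b a≁b))

  ≈-refl : ∀ {x} → x ≈ x
  ≈-refl {x} = someTriplePair⇒Separated {R = D} {ι = proj₁}
    (mapSomePair {Q′ = D x x} (λ { (x≢s , x≢t) → D-flip (D4 (≢-sym x≢s) (≢-sym x≢t)) })
      (avoidsTwoOfThree em ≡-isEquivalence (≁⇒≢ t₁≁t₂) (≁⇒≢ t₁≁t₃) (≁⇒≢ t₂≁t₃) x))

  ≈-sym : ∀ {x y} → x ≈ y → y ≈ x
  ≈-sym (a , b , a≁b , xyDab) = a , b , a≁b , D-swapˡ xyDab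

  D-replace : ∀ {x y v a b} → ¬ a ~ b → D x y (proj₁ a) (proj₁ b) → ¬ x ≈ v
    → D x y (proj₁ a) v
  D-replace {v = v} {a} {b} a≁b xyDab x≉v with D3 (D-swapˡ xyDab) v
  ... | inj₁ vxDab = ⊥-elim (x≉v (≈-sym (a , b , a≁b , vxDab)))
  ... | inj₂ yxDav = D-swapˡ yxDav

  -- If x ≉ z, D3 lets z replace b (resp. a) in D(xy;ab) and x replace d (resp. c) in D(yz;cd);
  -- combining the results gives D(ab;cd) for two pairs straddling C.
  ≈-trans : ∀ {x y z} → x ≈ y → y ≈ z → x ≈ z
  ≈-trans {x} {y} {z} (a , b , a≁b , xyDab) (c , d , c≁d , yzDcd) = em⇒dne em λ x≉z →
    ¬D-straddling a≁b c≁d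
      (D-trans (toward-cd x≉z (D-replace a≁b xyDab x≉z))
               (D-swapˡ (toward-cd x≉z (D-replace (a≁b ∘ C.sym) (D-swapʳ xyDab) x≉z))))
    where
    toward-cd : ¬ x ≈ z → ∀ {e} → D x y e z → D e z (proj₁ c) (proj₁ d)
    toward-cd x≉z xyDez =
      D-transʳ (D-exchange xyDez (yzD-x c≁d yzDcd))
               (D-swapʳ (D-exchange xyDez (yzD-x (c≁d ∘ C.sym) (D-swapʳ yzDcd))))
      where
      yzD-x : ∀ {e f} → ¬ e ~ f → D y z (proj₁ e) (proj₁ f) → D y z (proj₁ e) x
      yzD-x e≁f yzDef = D-swapˡ (D-replace e≁f (D-swapˡ yzDef) (x≉z ∘ ≈-sym))

  ≈-sectorD : ∀ {x y c d} → x ≈ y → ¬ x ≈ c → ¬ x ≈ d → D x y c d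
  ≈-sectorD (a , b , a≁b , xyDab) x≉c x≉d =
    D-transʳ (D-swapʳ (D-replace a≁b xyDab x≉c)) (D-replace a≁b xyDab x≉d)

  D-sameˡ⇒≈ : ∀ {s t y z w} → ¬ s ~ t → D (proj₁ s) y z w → D (proj₁ t) y z w → z ≈ w
  D-sameˡ⇒≈ {s} {t} s≁t syDzw tyDzw = s , t , s≁t , D-flip (D-trans syDzw (D-swapˡ tyDzw))

  D-sameʳ⇒≈ : ∀ {s t x y z} → ¬ s ~ t → D x y z (proj₁ s) → D x y z (proj₁ t) → x ≈ y
  D-sameʳ⇒≈ {s} {t} s≁t xyDzs xyDzt = s , t , s≁t , D-transʳ (D-swapʳ xyDzs) xyDzt

  -- Each tᵢ replaces x or w in D(xy;zw) (axiom D3), and two of them make the same choice.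
  ≈-fourParts : ∀ {x y z w} → ¬ x ≈ y → ¬ x ≈ z → ¬ x ≈ w → ¬ y ≈ z → ¬ y ≈ w → ¬ z ≈ w
    → ¬ D x y z w
  ≈-fourParts {x} {y} {z} {w} x≉y _ _ _ _ z≉w xyDzw
    with D3 xyDzw (proj₁ t₁) | D3 xyDzw (proj₁ t₂) | D3 xyDzw (proj₁ t₃)
  ... | inj₁ u | inj₁ v | _      = z≉w (D-sameˡ⇒≈ t₁≁t₂ u v)
  ... | inj₁ u | inj₂ _ | inj₁ v = z≉w (D-sameˡ⇒≈ t₁≁t₃ u v)
  ... | inj₂ _ | inj₁ u | inj₁ v = z≉w (D-sameˡ⇒≈ t₂≁t₃ u v)
  ... | inj₂ u | inj₂ v | _      = x≉y (D-sameʳ⇒≈ t₁≁t₂ u v)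
  ... | inj₂ u | inj₁ _ | inj₂ v = x≉y (D-sameʳ⇒≈ t₁≁t₃ u v)
  ... | inj₁ _ | inj₂ u | inj₂ v = x≉y (D-sameʳ⇒≈ t₂≁t₃ u v)

  splitting : Splitting D
  splitting = record
    { _∼_       = _≈_
    ; isEquiv   = record { refl = ≈-refl ; sym = ≈-sym ; trans = ≈-trans }
    ; twoParts  = proj₁ t₁ , proj₁ t₂ , λ { (a , b , a≁b , D) → ¬D-straddling t₁≁t₂ a≁b D }
    ; sectorD   = ≈-sectorD
    ; fourParts = ≈-fourParts
    }

  ∼⇔≈ : ∀ {a b} → a ~ b ⇔ proj₁ a ≈ proj₁ b
  ∼⇔≈ = ∼⇔Separated {R = induced D A} D1 D2 C (λ a → a) (λ _ _ a∼b → a∼b)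

  extends : Extends C splitting
  extends a = proj₁ a , λ b → Equivalence.to ∼⇔≈ , Equivalence.from ∼⇔≈

  extensions-agree : (C₁ C₂ : Splitting D) → Extends C C₁ → Extends C C₂ → SameSplitting C₁ C₂
  extensions-agree C₁ C₂ ext₁ ext₂ x y = Equivalence.to ∼₁⇔∼₂ , Equivalence.from ∼₁⇔∼₂
    where
    ∼₁⇔∼₂ : _∼_ C₁ x y ⇔ _∼_ C₂ x y
    ∼₁⇔∼₂ = ⇔.trans (∼⇔Separated {R = D} D1 D2 C₁ proj₁ (Extends-reflects C C₁ ext₁))
                    (⇔.sym (∼⇔Separated {R = D} D1 D2 C₂ proj₁ (Extends-reflects C C₂ ext₂)))

module Bipartition {X : Set} {R : QRel X} (em : ExcludedMiddle 0ℓ)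
  (R-flip : ∀ {w x y z} → R w x y z → R y z w x)
  (Side : X → Set) (p : X) (p-in : Side p) (q : X) (q-out : ¬ Side q)
  (R-across : ∀ {x y c d} → ¬ Side x → ¬ Side y → Side c → Side d → R x y c d) where

  private
    _≈_ : X → X → Set
    _≈_ = _⇔_ on Side

  both : ∀ {x y} → Side x → Side y → x ≈ y
  both x-in y-in = mk⇔ (λ _ → y-in) (λ _ → x-in)

  neither : ∀ {x y} → ¬ Side x → ¬ Side y → x ≈ y
  neither x-out y-out = mk⇔ (⊥-elim ∘ x-out) (⊥-elim ∘ y-out)

  ≉-in⇒out : ∀ {x y} → ¬ x ≈ y → Side x → ¬ Side y
  ≉-in⇒out x≉y x-in y-in = x≉y (both x-in y-in)

  ≉-out⇒in : ∀ {x y} → ¬ x ≈ y → ¬ Side x → Side y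
  ≉-out⇒in x≉y x-out = em⇒dne em λ y-out → x≉y (neither x-out y-out)

  ≈-sectorD : ∀ {x y c d} → x ≈ y → ¬ x ≈ c → ¬ x ≈ d → R x y c d
  ≈-sectorD {x} x≈y x≉c x≉d with em {Side x}
  ... | yes x-in = R-flip (R-across (≉-in⇒out x≉c x-in) (≉-in⇒out x≉d x-in)
                                    x-in (Equivalence.to x≈y x-in))
  ... | no x-out = R-across x-out (x-out ∘ Equivalence.from x≈y)
                            (≉-out⇒in x≉c x-out) (≉-out⇒in x≉d x-out)

  ≈-atMostTwoParts : ∀ {x y z} → ¬ x ≈ y → ¬ x ≈ z → y ≈ z
  ≈-atMostTwoParts {x} x≉y x≉z with em {Side x}
  ... | yes x-in = neither (≉-in⇒out x≉y x-in) (≉-in⇒out x≉z x-in)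
  ... | no x-out = both (≉-out⇒in x≉y x-out) (≉-out⇒in x≉z x-out)

  p≉q : ¬ p ≈ q
  p≉q p≈q = q-out (Equivalence.to p≈q p-in)

  splitting : Splitting R
  splitting = record
    { _∼_       = _≈_
    ; isEquiv   = isEquivalence Side ⇔.⇔-isEquivalence
    ; twoParts  = p , q , p≉q
    ; sectorD   = ≈-sectorD
    ; fourParts = λ x≉y x≉z _ y≉z _ _ _ → y≉z (≈-atMostTwoParts x≉y x≉z)
    }

  p-or-q : ∀ c → p ≈ c ⊎ q ≈ c
  p-or-q c with em {Side c}
  ... | yes c-in = inj₁ (both p-in c-in)
  ... | no c-out = inj₂ (neither q-out c-out)

  isEdge : IsEdge splitting
  isEdge = p , q , p≉q , p-or-q

module EdgeExtension {Ω : Set} {D : QRel Ω} (em : ExcludedMiddle 0ℓ) (ds : IsDSet D)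
  {A : Ω → Set} (C : Splitting (induced D A)) (a₀ b₀ : Σ Ω A)
  (a₀≁b₀ : ¬ _∼_ C a₀ b₀) (a₀-or-b₀ : ∀ c → _∼_ C a₀ c ⊎ _∼_ C b₀ c) where

  open DSetProperties ds

  private
    _~_ = _∼_ C
    module C = IsEquivalence (isEquiv C)

  OnB₀Side : Ω → Set
  OnB₀Side ω = ∀ {a a′ b} → a₀ ~ a → a₀ ~ a′ → b₀ ~ b → D ω (proj₁ b) (proj₁ a) (proj₁ a′)

  b₀Sector-onB₀Side : ∀ {c} → b₀ ~ c → OnB₀Side (proj₁ c)
  b₀Sector-onB₀Side {c} b₀∼c a₀∼a a₀∼a′ b₀∼b =
    sectorD C (C.trans (C.sym b₀∼c) b₀∼b) (not-a₀Sector a₀∼a) (not-a₀Sector a₀∼a′)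
    where
    not-a₀Sector : ∀ {a} → a₀ ~ a → ¬ c ~ a
    not-a₀Sector a₀∼a c∼a = a₀≁b₀ (C.trans a₀∼a (C.sym (C.trans b₀∼c c∼a)))

  a₀Sector-¬onB₀Side : ∀ {c} → a₀ ~ c → ¬ OnB₀Side (proj₁ c)
  a₀Sector-¬onB₀Side a₀∼c c-on = ¬D-repeat (c-on a₀∼c a₀∼c C.refl)

  a₀Sector-D : ∀ {a a′ c d} → a₀ ~ a → a₀ ~ a′ → OnB₀Side c → OnB₀Side d
    → D (proj₁ a) (proj₁ a′) c d
  a₀Sector-D a₀∼a a₀∼a′ c-on d-on =
    D-flip (D-trans (c-on a₀∼a a₀∼a′ C.refl) (D-swapˡ (d-on a₀∼a a₀∼a′ C.refl)))

  D-pivot : ∀ {x a a′ b c d} → a₀ ~ a → a₀ ~ a′ → b₀ ~ b → OnB₀Side c → OnB₀Side d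
    → ¬ D x (proj₁ b) (proj₁ a) (proj₁ a′) → D x (proj₁ a′) c d
  D-pivot {x} a₀∼a a₀∼a′ b₀∼b c-on d-on ¬xbDaa′
    with D3 (a₀Sector-D a₀∼a a₀∼a′ c-on d-on) x
  ... | inj₁ xa′Dcd = xa′Dcd
  ... | inj₂ aa′Dcx =
    ⊥-elim (¬xbDaa′ (D-flip (D-transʳ (D-swapʳ aa′Dcx) (D-flip (c-on a₀∼a a₀∼a′ b₀∼b)))))

  ¬onB₀Side⇒D : ∀ {x c d} → ¬ OnB₀Side x → OnB₀Side c → OnB₀Side d
    → ∃[ a ] (a₀ ~ a × D x (proj₁ a) c d)
  ¬onB₀Side⇒D x-off c-on d-on = em⇒dne em λ none →
    x-off λ {a} {a′} a₀∼a a₀∼a′ b₀∼b → em⇒dne em λ ¬xbDaa′ →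
      none (a′ , a₀∼a′ , D-pivot a₀∼a a₀∼a′ b₀∼b c-on d-on ¬xbDaa′)

  D-across : ∀ {x y c d} → ¬ OnB₀Side x → ¬ OnB₀Side y → OnB₀Side c → OnB₀Side d → D x y c d
  D-across x-off y-off c-on d-on
    with ¬onB₀Side⇒D x-off c-on d-on | ¬onB₀Side⇒D y-off c-on d-on
  ... | a , a₀∼a , xaDcd | a′ , a₀∼a′ , ya′Dcd =
    D-trans (D-trans xaDcd (a₀Sector-D a₀∼a a₀∼a′ c-on d-on)) (D-swapˡ ya′Dcd)

  open Bipartition em D-flip OnB₀Side (proj₁ b₀) (b₀Sector-onB₀Side C.refl)
    (proj₁ a₀) (a₀Sector-¬onB₀Side C.refl) D-across
    public using (splitting; isEdge; both; neither)

  sameSector⇒sameSide : ∀ a b → a ~ b → _∼_ splitting (proj₁ a) (proj₁ b)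
  sameSector⇒sameSide a b a∼b with a₀-or-b₀ a
  ... | inj₁ a₀∼a = neither (a₀Sector-¬onB₀Side a₀∼a) (a₀Sector-¬onB₀Side (C.trans a₀∼a a∼b))
  ... | inj₂ b₀∼a = both (b₀Sector-onB₀Side b₀∼a) (b₀Sector-onB₀Side (C.trans b₀∼a a∼b))

  sameSide⇒sameSector : ∀ a b → _∼_ splitting (proj₁ a) (proj₁ b) → a ~ b
  sameSide⇒sameSector a b a≈b with a₀-or-b₀ a | a₀-or-b₀ b
  ... | inj₁ a₀∼a | inj₁ a₀∼b = C.trans (C.sym a₀∼a) a₀∼b
  ... | inj₂ b₀∼a | inj₂ b₀∼b = C.trans (C.sym b₀∼a) b₀∼b
  ... | inj₁ a₀∼a | inj₂ b₀∼b =
    ⊥-elim (a₀Sector-¬onB₀Side a₀∼a (Equivalence.from a≈b (b₀Sector-onB₀Side b₀∼b)))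
  ... | inj₂ b₀∼a | inj₁ a₀∼b =
    ⊥-elim (a₀Sector-¬onB₀Side a₀∼b (Equivalence.to a≈b (b₀Sector-onB₀Side b₀∼a)))

  extends : Extends C splitting
  extends a = proj₁ a , λ b → sameSector⇒sameSide a b , sameSide⇒sameSector a b

mainTheorem11 : ExcludedMiddle 0ℓ
    → (Ω : Set) (D : QRel Ω) → IsDSet D
    → (A : Ω → Set) (C : Splitting (induced D A))
    → (Σ[ C' ∈ Splitting D ] Extends C C')
      × (IsNode C → (C' C'' : Splitting D) → Extends C C' → Extends C C'' → SameSplitting C' C'')
      × (IsEdge C → Σ[ C' ∈ Splitting D ] (Extends C C' × IsEdge C'))
mainTheorem11 em Ω D ds A C = existence , uniqueness , edgeExtension
  where
  edgeExtension : IsEdge C → Σ[ C′ ∈ Splitting D ] (Extends C C′ × IsEdge C′)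
  edgeExtension (a₀ , b₀ , a₀≁b₀ , a₀-or-b₀) = splitting , extends , isEdge
    where open EdgeExtension em ds C a₀ b₀ a₀≁b₀ a₀-or-b₀

  nodeExtension : IsNode C → Σ[ C′ ∈ Splitting D ] Extends C C′
  nodeExtension (t₁ , t₂ , t₃ , t₁≁t₂ , t₁≁t₃ , t₂≁t₃) = splitting , extends
    where open NodeExtension em ds C t₁ t₂ t₃ t₁≁t₂ t₁≁t₃ t₂≁t₃

  existence : Σ[ C′ ∈ Splitting D ] Extends C C′
  existence with em {IsNode C}
  ... | yes node = nodeExtension node
  ... | no ¬node with edgeExtension (¬IsNode⇒IsEdge em C ¬node)
  ...   | C′ , extends , _ = C′ , extends

  uniqueness : IsNode C → (C₁ C₂ : Splitting D) → Extends C C₁ → Extends C C₂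
    → SameSplitting C₁ C₂
  uniqueness (t₁ , t₂ , t₃ , t₁≁t₂ , t₁≁t₃ , t₂≁t₃) = extensions-agree
    where open NodeExtension em ds C t₁ t₂ t₃ t₁≁t₂ t₁≁t₃ t₂≁t₃
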